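{- The logic Cycle-CTL* (CTL*CD) has neither the finite-model property nor the tree-model property. Moreover, CTL*CD is not invariant under (ordinary) bisimulation: there exist bisimilar Kripke structures $K_1,K_2$ and a CTL*CD state formula $\varphi$ such that $K_1\models\varphi$ and $K_2\not\models\varphi$.
   Context: Fix a finite set $AP$ of atomic propositions. A Kripke structure is $K=(AP,W,R,L,w_I)$ where $W$ is a countable non-empty set of worlds, $w_I\in W$ is the initial world, $R\subseteq W\times W$ is left-total (every world has an $R$-successor), and $L:W\to 2^{AP}$. A path is an infinite sequence $\pi=\pi_0\pi_1\cdots$ of worlds with $(\pi_i,\pi_{i+1})\in R$ for all $i\in\mathbb N$; $\mathrm{Pth}(w)$ is the set of paths with $\pi_0=w$. A path $\pi$ is a cycle if for every $i\in\mathbb N$ there is $j>i$ with $\pi_j=\pi_0$; $\mathrm{Cyc}(w)$ is the set of cycles with $\pi_0=w$. CTL*CD state formulas $\phi$ and path formulas $\psi$ are given by $\phi ::= p \mid \neg\phi\mid\phi\wedge\phi\mid\phi\vee\phi\mid \mathsf E\psi\mid\mathsf A\psi\mid \mathsf E^{\circlearrowleft}\psi\mid\mathsf A^{\circlearrowleft}\psi$ ($p\in AP$) and $\psi::=\phi\mid\neg\psi\mid\psi\wedge\psi\mid\psi\vee\psi\mid \mathsf X\psi\mid\psi\,\mathsf U\,\psi$. Semantics: $K,w\models p$ iff $p\in L(w)$; Boolean connectives as usual; $K,w\models\mathsf E\psi$ iff some $\pi\in\mathrm{Pth}(w)$ has $K,\pi,0\models\psi$; $K,w\models\mathsf A\psi$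 iff all $\pi\in\mathrm{Pth}(w)$ have $K,\pi,0\models\psi$; $K,w\models\mathsf E^{\circlearrowleft}\psi$ iff some $\pi\in\mathrm{Cyc}(w)$ has $K,\pi,0\models\psi$; $K,w\models\mathsf A^{\circlearrowleft}\psi$ iff all $\pi\in\mathrm{Cyc}(w)$ have $K,\pi,0\models\psi$. For paths: $K,\pi,i\models\phi$ iff $K,\pi_i\models\phi$ for state formulas; Boolean connectives as usual; $K,\pi,i\models\mathsf X\psi$ iff $K,\pi,i+1\models\psi$; $K,\pi,i\models\psi_1\mathsf U\psi_2$ iff there is $k\in\mathbb N$ with $K,\pi,i+k\models\psi_2$ and $K,\pi,i+j\models\psi_1$ for all $0\le j<k$. $K\models\phi$ iff $K,w_I\models\phi$; $\phi$ is satisfiable if $K\models\phi$ for some Kripke structure $K$. Derived: $\top$, $\mathsf F\psi=\top\mathsf U\psi$, $\mathsf G\psi=\neg\mathsf F\neg\psi$. Finite-model property: every satisfiable state formula is satisfied by a Kripke structure with finitely many worlds. Tree-model property: every satisfiable state formula is satisfied by a Kripke structure in which $(W,R)$ is a tree rooted at $w_I$. A (ordinary) bisimulation between $K_1,K_2$ is a relation $B\subseteq W_1\times W_2$ with $(w_{I,1},w_{I,2})\in B$ such that for $(w_1,w_2)\in B$: $L_1(w_1)=L_2(w_2)$, every $R_1$-successor of $w_1$ is $B$-related to some $R_2$-successor of $w_2$, and vice versa; $K_1,K_2$ are bisimilar if such $B$ exists. -}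

module Defs where

open import Data.Nat using (ℕ; zero; suc; _+_; _<_; _≤_)
open import Data.Fin using (Fin)
open import Data.Bool using (Bool; true)
open import Data.Product using (Σ; ∃; _×_; _,_; Σ-syntax; ∃-syntax)
open import Data.Sum using (_⊎_)
open import Relation.Nullary using (¬_)
open import Relation.Binary.PropositionalEquality using (_≡_)
open import Function.Definitions using (Injective)

-- W is countable (injects into ℕ) and non-empty (contains wI);
-- R is left-total; L w p ≡ true means p ∈ L(w)  (2^AP as
-- characteristic functions).

record Kripke (AP : Set) : Set₁ where
  field
    W         : Set
    R         : W → W → Set
    L         : W → AP → Bool
    wI        : W
    leftTotal : ∀ w → Σ[ w′ ∈ W ] R w w′
    countable : Σ[ f ∈ (W → ℕ) ] Injective _≡_ _≡_ f

open Kripke public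

IsPath : ∀ {AP} (K : Kripke AP) → (ℕ → W K) → Set
IsPath K π = ∀ i → R K (π i) (π (suc i))

PathFrom : ∀ {AP} (K : Kripke AP) → W K → (ℕ → W K) → Set
PathFrom K w π = IsPath K π × π 0 ≡ w

CycleFrom : ∀ {AP} (K : Kripke AP) → W K → (ℕ → W K) → Set
CycleFrom K w π = PathFrom K w π × (∀ i → Σ[ j ∈ ℕ ] (i < j × π j ≡ π 0))

mutual
  data SForm (AP : Set) : Set where
    atom      : AP → SForm AP
    ¬ˢ_       : SForm AP → SForm AP
    _∧ˢ_ _∨ˢ_ : SForm AP → SForm AP → SForm AP
    𝐄 𝐀 𝐄↺ 𝐀↺ : PForm AP → SForm AP

  data PForm (AP : Set) : Set where
    st        : SForm AP → PForm AP
    ¬ᵖ_       : PForm AP → PForm AP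
    _∧ᵖ_ _∨ᵖ_ : PForm AP → PForm AP → PForm AP
    𝐗         : PForm AP → PForm AP
    _𝐔_       : PForm AP → PForm AP → PForm AP

mutual
  SatS : ∀ {AP} (K : Kripke AP) → W K → SForm AP → Set
  SatS K w (atom p)   = L K w p ≡ true
  SatS K w (¬ˢ φ)     = ¬ SatS K w φ
  SatS K w (φ ∧ˢ φ′)  = SatS K w φ × SatS K w φ′
  SatS K w (φ ∨ˢ φ′)  = SatS K w φ ⊎ SatS K w φ′
  SatS K w (𝐄 ψ)      = Σ[ π ∈ (ℕ → W K) ] (PathFrom K w π × SatP K π 0 ψ)
  SatS K w (𝐀 ψ)      = ∀ (π : ℕ → W K) → PathFrom K w π → SatP K π 0 ψ
  SatS K w (𝐄↺ ψ)     = Σ[ π ∈ (ℕ → W K) ] (CycleFrom K w π × SatP K π 0 ψ)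
  SatS K w (𝐀↺ ψ)     = ∀ (π : ℕ → W K) → CycleFrom K w π → SatP K π 0 ψ

  SatP : ∀ {AP} (K : Kripke AP) → (ℕ → W K) → ℕ → PForm AP → Set
  SatP K π i (st φ)     = SatS K (π i) φ
  SatP K π i (¬ᵖ ψ)     = ¬ SatP K π i ψ
  SatP K π i (ψ ∧ᵖ ψ′)  = SatP K π i ψ × SatP K π i ψ′
  SatP K π i (ψ ∨ᵖ ψ′)  = SatP K π i ψ ⊎ SatP K π i ψ′
  SatP K π i (𝐗 ψ)      = SatP K π (suc i) ψ
  SatP K π i (ψ₁ 𝐔 ψ₂)  =
    Σ[ k ∈ ℕ ] (SatP K π (i + k) ψ₂ × (∀ j → j < k → SatP K π (i + j) ψ₁))

_⊨_ : ∀ {AP} (K : Kripke AP) → SForm AP → Set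
K ⊨ φ = SatS K (wI K) φ

Satisfiable : ∀ {AP} → SForm AP → Set₁
Satisfiable {AP} φ = Σ[ K ∈ Kripke AP ] (K ⊨ φ)

FiniteK : ∀ {AP} → Kripke AP → Set
FiniteK K = Σ[ n ∈ ℕ ] Σ[ f ∈ (W K → Fin n) ] Injective _≡_ _≡_ f

FinPath : ∀ {AP} (K : Kripke AP) → W K → W K → ℕ → (ℕ → W K) → Set
FinPath K a b n ρ = ρ 0 ≡ a × ρ n ≡ b × (∀ i → i < n → R K (ρ i) (ρ (suc i)))

IsTree : ∀ {AP} → Kripke AP → Set
IsTree K = ∀ (w : W K) →
  Σ[ n ∈ ℕ ] Σ[ ρ ∈ (ℕ → W K) ] (FinPath K (wI K) w n ρ ×
    (∀ (m : ℕ) (σ : ℕ → W K) → FinPath K (wI K) w m σ →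
       m ≡ n × (∀ i → i ≤ n → σ i ≡ ρ i)))

FiniteModelProperty : (AP : Set) → Set₁
FiniteModelProperty AP =
  ∀ (φ : SForm AP) → Satisfiable φ → Σ[ K ∈ Kripke AP ] (FiniteK K × K ⊨ φ)

TreeModelProperty : (AP : Set) → Set₁
TreeModelProperty AP =
  ∀ (φ : SForm AP) → Satisfiable φ → Σ[ K ∈ Kripke AP ] (IsTree K × K ⊨ φ)

IsBisimulation : ∀ {AP} (K₁ K₂ : Kripke AP) → (W K₁ → W K₂ → Set) → Set
IsBisimulation K₁ K₂ B =
  B (wI K₁) (wI K₂) ×
  (∀ w₁ w₂ → B w₁ w₂ →
     (∀ p → L K₁ w₁ p ≡ L K₂ w₂ p) ×
     (∀ v₁ → R K₁ w₁ v₁ → Σ[ v₂ ∈ W K₂ ] (R K₂ w₂ v₂ × B v₁ v₂)) ×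
     (∀ v₂ → R K₂ w₂ v₂ → Σ[ v₁ ∈ W K₁ ] (R K₁ w₁ v₁ × B v₁ v₂)))

Bisimilar : ∀ {AP} → Kripke AP → Kripke AP → Set₁
Bisimilar K₁ K₂ = Σ[ B ∈ (W K₁ → W K₂ → Set) ] IsBisimulation K₁ K₂ B

-- In the naturals with the successor relation
-- no world lies on a cycle, while in a finite structure some world reachable from the root
-- repeats along any run, and a repetition unrolls into a cycle; so "no reachable world lies on
-- a cycle" has only infinite models. In a tree a cycle from the root would be a second path
-- from the root to itself, so "the root lies on a cycle" has no tree model, although a single
-- reflexive world satisfies it. That reflexive world is bisimilar to a root with an edge into
-- it, which is on no cycle: cycles, unlike paths, are not preserved by bisimulation.
module Submission where

open import Defs
open import Data.Nat using (ℕ; suc)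
open import Data.Fin using (Fin)
open import Data.Product using (Σ; _×_; Σ-syntax)
open import Relation.Nullary using (¬_)

open import Data.Nat using (zero; _+_; _*_; _%_; _/_; _<_; _≤_; NonZero)
open import Data.Nat.Properties
  using (+-comm; 0≢1+n; m≤n⇒m<n∨m≡n; m≤n⇒∃[o]m+o≡n; m≤m*n; m≢1+n+m; n<1+n)
open import Data.Nat.DivMod
  using (m≡m%n+[m/n]*n; %-congˡ; [m+kn]%n≡m%n; m%n<n; m<n⇒m%n≡m; n%n≡0; m*n%n≡0)
open import Data.Fin using (toℕ) renaming (zero to 0F; suc to sucF)
open import Data.Fin.Properties using (pigeonhole; toℕ-injective)
open import Data.Bool using (false)
open import Data.Product using (_,_; proj₁; proj₂; ∃)
open import Data.Sum using (inj₁; inj₂)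
open import Data.Unit using (⊤; tt)
open import Function using (_∘_)
open import Relation.Binary.PropositionalEquality
  using (_≡_; refl; sym; trans; cong; subst; module ≡-Reasoning)

[1+m]%n≡[1+m%n]%n : ∀ m n .{{_ : NonZero n}} → suc m % n ≡ suc (m % n) % n
[1+m]%n≡[1+m%n]%n m n = begin
  suc m % n                         ≡⟨ %-congˡ (cong suc (m≡m%n+[m/n]*n m n)) ⟩
  (suc (m % n) + (m / n) * n) % n   ≡⟨ [m+kn]%n≡m%n (suc (m % n)) (m / n) n ⟩
  suc (m % n) % n                   ∎
  where open ≡-Reasoning

OnCycle : ∀ {AP} (K : Kripke AP) → W K → Set
OnCycle K w = Σ[ σ ∈ (ℕ → W K) ] CycleFrom K w σ

module _ {AP : Set} (K : Kripke AP) where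

  closedWalk⇒cycle : ∀ {w d ρ} → FinPath K w w (suc d) ρ →
                     CycleFrom K w (λ m → ρ (m % suc d))
  closedWalk⇒cycle {d = d} {ρ} (ρ₀ , ρₚ , step) = (path , ρ₀) , returns
    where
      p : ℕ
      p = suc d

      ρ-mod : ∀ k → k ≤ p → ρ k ≡ ρ (k % p)
      ρ-mod k k≤p with m≤n⇒m<n∨m≡n k≤p
      ... | inj₁ k<p  = cong ρ (sym (m<n⇒m%n≡m k<p))
      ... | inj₂ refl = trans ρₚ (trans (sym ρ₀) (cong ρ (sym (n%n≡0 p))))

      path : IsPath K (λ m → ρ (m % p))
      path m = subst (R K (ρ r))
                     (trans (ρ-mod (suc r) (m%n<n m p)) (cong ρ (sym ([1+m]%n≡[1+m%n]%n m p))))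
                     (step r (m%n<n m p))
        where
          r : ℕ
          r = m % p

      returns : ∀ m → Σ[ m′ ∈ ℕ ] (m < m′ × ρ (m′ % p) ≡ ρ 0)
      returns m = suc m * p , m≤m*n (suc m) p , cong ρ (m*n%n≡0 (suc m) p)

  cycle⇒closedWalk : ∀ {w σ} → CycleFrom K w σ → ∃ λ d → FinPath K w w (suc d) σ
  cycle⇒closedWalk ((σ-path , σ₀) , returns) with returns 0
  ... | suc d , _ , σ-return = d , σ₀ , trans σ-return σ₀ , λ i _ → σ-path i

  repetition⇒closedWalk : ∀ {π i j} → IsPath K π → i < j → π i ≡ π j →
                          ∃ λ d → FinPath K (π i) (π i) (suc d) (λ k → π (k + i))
  repetition⇒closedWalk {π} {i} π-path i<j πᵢ≡πⱼ
    with d , refl ← m≤n⇒∃[o]m+o≡n i<j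
    = d , refl , trans (cong (π ∘ suc) (+-comm d i)) (sym πᵢ≡πⱼ) , λ k _ → π-path (k + i)

  run : ℕ → W K
  run zero    = wI K
  run (suc k) = proj₁ (leftTotal K (run k))

  run-isPath : IsPath K run
  run-isPath k = proj₂ (leftTotal K (run k))

  finite⇒reachableCycle : FiniteK K → Σ[ i ∈ ℕ ] OnCycle K (run i)
  finite⇒reachableCycle (m , f , f-inj)
    with x , _ , x<y , fx≡fy ← pigeonhole (n<1+n m) (λ x → f (run (toℕ x)))
    with _ , walk ← repetition⇒closedWalk run-isPath x<y (f-inj fx≡fy)
    = toℕ x , _ , closedWalk⇒cycle walk

  tree⇒¬rootOnCycle : IsTree K → ¬ OnCycle K (wI K)
  tree⇒¬rootOnCycle tree (σ , cycle)
    with d , walk ← cycle⇒closedWalk cycle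
    with _ , _ , _ , unique ← tree (wI K)
    = 0≢1+n (trans (proj₁ (unique 0 (λ _ → wI K) (refl , refl , λ _ ())))
                   (sym (proj₁ (unique (suc d) σ walk))))

ℕ-successor : ∀ {AP} → Kripke AP
ℕ-successor = record
  { W = ℕ ; R = λ m n → n ≡ suc m ; L = λ _ _ → false ; wI = 0
  ; leftTotal = λ m → suc m , refl ; countable = (λ m → m) , λ eq → eq }

ℕ-successor-acyclic : ∀ {AP} n → ¬ OnCycle (ℕ-successor {AP}) n
ℕ-successor-acyclic n (σ , (σ-path , _) , returns)
  with suc j , _ , σ-return ← returns 0
  = m≢1+n+m (σ 0) (trans (sym σ-return) (σ-grows (suc j)))
  where
    σ-grows : ∀ m → σ m ≡ m + σ 0
    σ-grows zero    = refl
    σ-grows (suc m) = trans (σ-path m) (cong suc (σ-grows m))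

reflexivePoint : ∀ {AP} → Kripke AP
reflexivePoint = record
  { W = Fin 1 ; R = λ _ _ → ⊤ ; L = λ _ _ → false ; wI = 0F
  ; leftTotal = λ w → w , tt ; countable = toℕ , toℕ-injective }

reflexivePoint-onCycle : ∀ {AP} → OnCycle (reflexivePoint {AP}) 0F
reflexivePoint-onCycle = (λ _ → 0F) , ((λ _ → tt) , refl) , λ m → suc m , n<1+n m , refl

lasso : ∀ {AP} → Kripke AP
lasso = record
  { W = Fin 2 ; R = λ _ v → v ≡ sucF 0F ; L = λ _ _ → false ; wI = 0F
  ; leftTotal = λ _ → sucF 0F , refl ; countable = toℕ , toℕ-injective }

lasso-rootAcyclic : ∀ {AP} → ¬ OnCycle (lasso {AP}) 0F
lasso-rootAcyclic (σ , (σ-path , σ₀) , returns)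
  with suc j , _ , σ-return ← returns 0
  with () ← trans (sym (σ-path j)) (trans σ-return σ₀)

reflexivePoint∼lasso : ∀ {AP} → Bisimilar (reflexivePoint {AP}) lasso
reflexivePoint∼lasso =
  (λ _ _ → ⊤) , tt , λ _ _ _ → (λ _ → refl) , (λ _ _ → sucF 0F , refl , tt) , (λ _ _ → 0F , tt , tt)

module _ {AP : Set} (p : AP) where

  ⊤ˢ : SForm AP
  ⊤ˢ = ¬ˢ (atom p ∧ˢ (¬ˢ atom p))

  ⊨⊤ˢ : ∀ (K : Kripke AP) {w} → SatS K w ⊤ˢ
  ⊨⊤ˢ _ (p∈L , p∉L) = p∉L p∈L

  onCycle : SForm AP
  onCycle = 𝐄↺ (st ⊤ˢ)

  noReachableCycle : SForm AP
  noReachableCycle = ¬ˢ 𝐄 (st ⊤ˢ 𝐔 st onCycle)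

  onCycle-sound : ∀ (K : Kripke AP) {w} → SatS K w onCycle → OnCycle K w
  onCycle-sound _ (σ , cycle , _) = σ , cycle

  onCycle-complete : ∀ (K : Kripke AP) {w} → OnCycle K w → SatS K w onCycle
  onCycle-complete K (σ , cycle) = σ , cycle , ⊨⊤ˢ K

  finite⇒⊭noReachableCycle : ∀ (K : Kripke AP) → FiniteK K → ¬ (K ⊨ noReachableCycle)
  finite⇒⊭noReachableCycle K finite sat
    with i , onCycleᵢ ← finite⇒reachableCycle K finite
    = sat (run K , (run-isPath K , refl) , i , onCycle-complete K onCycleᵢ , λ _ _ → ⊨⊤ˢ K)

  ℕ-successor⊨noReachableCycle : ℕ-successor ⊨ noReachableCycle
  ℕ-successor⊨noReachableCycle (_ , _ , _ , onCycleᵢ , _) =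
    ℕ-successor-acyclic {AP} _ (onCycle-sound ℕ-successor onCycleᵢ)

  reflexivePoint⊨onCycle : reflexivePoint ⊨ onCycle
  reflexivePoint⊨onCycle = onCycle-complete reflexivePoint (reflexivePoint-onCycle {AP})

  lasso⊭onCycle : ¬ (lasso ⊨ onCycle)
  lasso⊭onCycle sat = lasso-rootAcyclic {AP} (onCycle-sound lasso sat)

  ¬finiteModelProperty : ¬ FiniteModelProperty AP
  ¬finiteModelProperty fmp
    with K , finite , sat ← fmp noReachableCycle (ℕ-successor , ℕ-successor⊨noReachableCycle)
    = finite⇒⊭noReachableCycle K finite sat

  ¬treeModelProperty : ¬ TreeModelProperty AP
  ¬treeModelProperty tmp
    with K , tree , sat ← tmp onCycle (reflexivePoint , reflexivePoint⊨onCycle)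
    = tree⇒¬rootOnCycle K tree (onCycle-sound K sat)

mainTheorem1 : ∀ (n : ℕ) →
    ¬ FiniteModelProperty (Fin (suc n)) ×
    ¬ TreeModelProperty (Fin (suc n)) ×
    Σ[ K₁ ∈ Kripke (Fin (suc n)) ] Σ[ K₂ ∈ Kripke (Fin (suc n)) ]
      Σ[ φ ∈ SForm (Fin (suc n)) ]
        (Bisimilar K₁ K₂ × K₁ ⊨ φ × ¬ (K₂ ⊨ φ))
mainTheorem1 n =
  ¬finiteModelProperty p , ¬treeModelProperty p ,
  reflexivePoint , lasso , onCycle p ,
  reflexivePoint∼lasso , reflexivePoint⊨onCycle p , lasso⊭onCycle p
  where
    p : Fin (suc n)
    p = 0F
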